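{- Let $\mathbf C=(C,\leq,\odot,\rightarrow,{}',0,1)$ be a strict unsharp residuated poset and put $x+y:=(x'\odot y')'$, defined if and only if $x\leq y'$ ($x,y\in C$). Then $(C,+,{}',0,1)$ is an effect algebra whose induced order coincides with $\leq$.
   Context: In a poset, $L(A)$, $U(A)$ are the sets of lower, resp. upper, bounds of $A$; $L(x,y)=L(\{x,y\})$, $UL(A)=U(L(A))$. A partial commutative monoid $(C,\odot,1)$: $\odot$ partial binary, $(x\odot y)\odot z$ defined iff $x\odot(y\odot z)$ defined and then equal, $x\odot 1=1\odot x=x$, $x\odot y$ defined iff $y\odot x$ defined and then equal. For $A\subseteq C$, $A\odot y=\{a\odot y\mid a\in A\}$ when all these are defined. A strict unsharp residuated poset is $(C,\leq,\odot,\rightarrow,{}',0,1)$ with $\rightarrow:C^2\to 2^C$ such that for all $x,y,z\in C$: (C1) $(C,\leq,{}',0,1)$ is a bounded poset with an antitone involution $'$; (C2) $(C,\odot,1)$ is a partial commutative monoid in which $x\odot y$ is defined iff $x'\leq y$; moreover $z'\leq x\leq y$ implies $x\odot z\leq y\odot z$, and $x\leq y$ implies $x=y\odot(y\odot x')'$; (C3) $U(x,y')\odot y\subseteq UL(y,z)$ iff $U(x,y')\subseteq U(y\rightarrow z)$; (C4) $x\rightarrow 0=\{x'\}$. An effect algebra is a partial algebra $(E,+,{}',0,1)$ of type $(2,1,0,0)$ with $+$ partial such that: (E1) $x+y$ defined iff $y+x$ defined, then equal; (E2) $(x+y)+z$ defined iff $x+(y+z)$ defined, then equal; (E3) $x'$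 is the unique $u$ with $x+u=1$; (E4) if $1+x$ is defined then $x=0$. Its induced order: $x\leq y$ iff $x+z=y$ for some $z$. -}

module Defs where

open import Data.Maybe using (Maybe; just; nothing; _>>=_) renaming (map to mapMaybe)
open import Data.Sum using (_⊎_)
open import Data.Product using (Σ; ∃; _×_; _,_)
open import Relation.Binary.PropositionalEquality using (_≡_)
open import Relation.Binary.Structures using (IsPartialOrder)

Subset : Set → Set₁
Subset C = C → Set

_⊆_ : {C : Set} → Subset C → Subset C → Set
A ⊆ B = ∀ c → A c → B c

_⟺_ : Set → Set → Set
P ⟺ Q = (P → Q) × (Q → P)

-- Partial binary operations are modelled as total maps into Maybe;
-- "x ⊙ y is defined" means  ∃ z . x ⊙ y ≡ just z.
Defined : {C : Set} → Maybe C → Set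
Defined {C} m = ∃ λ (z : C) → m ≡ just z

module PosetNotions {C : Set} (_≤_ : C → C → Set) where
  U : Subset C → Subset C
  U A u = ∀ a → A a → a ≤ u

  L : Subset C → Subset C
  L A l = ∀ a → A a → l ≤ a

  pair : C → C → Subset C
  pair x y c = (c ≡ x) ⊎ (c ≡ y)

  U₂ : C → C → Subset C
  U₂ x y = U (pair x y)

  L₂ : C → C → Subset C
  L₂ x y = L (pair x y)

  UL : Subset C → Subset C
  UL A = U (L A)

_⊙[_]_ : {C : Set} → Subset C → (C → C → Maybe C) → C → Subset C
(A ⊙[ op ] y) c = ∃ λ a → A a × op a y ≡ just c

-- Kleisli composites expressing the partial-associativity law:
-- (x ⊙ y) ⊙ z  and  x ⊙ (y ⊙ z), both `nothing` when undefined.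
assocL : {C : Set} → (C → C → Maybe C) → C → C → C → Maybe C
assocL op x y z = op x y >>= λ a → op a z

assocR : {C : Set} → (C → C → Maybe C) → C → C → C → Maybe C
assocR op x y z = op y z >>= λ b → op x b

record StrictUnsharpResiduatedPoset : Set₁ where
  infix 4 _≤_
  field
    Carrier : Set
    _≤_     : Carrier → Carrier → Set
    _⊙_     : Carrier → Carrier → Maybe Carrier
    _⇒_     : Carrier → Carrier → Subset Carrier
    _′      : Carrier → Carrier
    𝟘 𝟙     : Carrier

  open PosetNotions _≤_ public

  field
    isPartialOrder : IsPartialOrder _≡_ _≤_
    𝟘-least        : ∀ x → 𝟘 ≤ x
    𝟙-greatest     : ∀ x → x ≤ 𝟙
    ′-involutive   : ∀ x → (x ′) ′ ≡ x
    ′-antitone     : ∀ {x y} → x ≤ y → y ′ ≤ x ′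
    ⊙-assoc        : ∀ x y z → assocL _⊙_ x y z ≡ assocR _⊙_ x y z
    ⊙-identityʳ    : ∀ x → x ⊙ 𝟙 ≡ just x
    ⊙-identityˡ    : ∀ x → 𝟙 ⊙ x ≡ just x
    ⊙-comm         : ∀ x y → x ⊙ y ≡ y ⊙ x
    ⊙-defined      : ∀ x y → Defined (x ⊙ y) ⟺ (x ′ ≤ y)
    ⊙-mono         : ∀ {x y z a b} → z ′ ≤ x → x ≤ y →
                     x ⊙ z ≡ just a → y ⊙ z ≡ just b → a ≤ b
    ⊙-cancel       : ∀ {x y} → x ≤ y →
                     (y ⊙ (x ′) >>= λ w → y ⊙ (w ′)) ≡ just x
    adjoint        : ∀ x y z →
                     ((U₂ x (y ′) ⊙[ _⊙_ ] y) ⊆ UL (pair y z))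
                       ⟺ (U₂ x (y ′) ⊆ U (y ⇒ z))
    ⇒-𝟘            : ∀ x w → (x ⇒ 𝟘) w ⟺ (w ≡ x ′)

record IsEffectAlgebra {E : Set} (_+_ : E → E → Maybe E) (_′ : E → E) (𝟘 𝟙 : E) : Set where
  field
    +-comm   : ∀ x y → x + y ≡ y + x
    +-assoc  : ∀ x y z → assocL _+_ x y z ≡ assocR _+_ x y z
    ′-sum    : ∀ x → x + (x ′) ≡ just 𝟙
    ′-unique : ∀ x u → x + u ≡ just 𝟙 → u ≡ x ′
    𝟙-zero   : ∀ x → Defined (𝟙 + x) → x ≡ 𝟘

InducedOrder : {E : Set} → (E → E → Maybe E) → E → E → Set
InducedOrder _+_ x y = ∃ λ z → x + z ≡ just y

-- x + y := (x' ⊙ y')' , defined exactly when x' ⊙ y' is defined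
-- (i.e. by (C2) iff x'' ≤ y', i.e. iff x ≤ y').
module _ (𝐂 : StrictUnsharpResiduatedPoset) where
  open StrictUnsharpResiduatedPoset 𝐂
  plusOf : Carrier → Carrier → Maybe Carrier
  plusOf x y = mapMaybe _′ ((x ′) ⊙ (y ′))

-- Everything is transported along the antitone involution: x + y is the de Morgan dual of x′ ⊙ y′,
-- so commutativity and associativity are those of ⊙.  The law  x ≤ y ⇒ x = y ⊙ (y ⊙ x′)′  of (C2)
-- yields x ⊙ x′ = 0, which gives x + x′ = 1 and the uniqueness of complements, and it also supplies
-- the witness z with x + z = y when x ≤ y.  Conversely x + z = y means y′ = z′ ⊙ x′ ≤ 1 ⊙ x′ = x′
-- by monotonicity of ⊙.
module Submission where

open import Defs
open import Data.Maybe using (Maybe; just; nothing; _>>=_) renaming (map to mapMaybe)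
open import Data.Maybe.Properties using (just-injective; map-just)
open import Data.Product using (_×_; _,_; ∃; proj₁)
open import Relation.Binary.PropositionalEquality
  using (_≡_; refl; sym; trans; cong; subst; module ≡-Reasoning)
open import Relation.Binary.Structures using (IsPartialOrder)

>>=-just : {A B : Set} {m : Maybe A} {f : A → Maybe B} {b : B} →
           (m >>= f) ≡ just b → ∃ λ a → m ≡ just a × f a ≡ just b
>>=-just {m = just a} e = a , refl , e

module Properties (𝐂 : StrictUnsharpResiduatedPoset) where
  open StrictUnsharpResiduatedPoset 𝐂
  open IsPartialOrder isPartialOrder using (antisym)

  ′-injective : ∀ {x y} → x ′ ≡ y ′ → x ≡ y
  ′-injective {x} {y} e = trans (sym (′-involutive x)) (trans (cong _′ e) (′-involutive y))

  ′-reflects-≤ : ∀ {x y} → x ′ ≤ y ′ → y ≤ x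
  ′-reflects-≤ {x} {y} le with ′-antitone le
  ... | le′ rewrite ′-involutive x | ′-involutive y = le′

  ≤′-swap : ∀ {x y} → x ≤ y ′ → y ≤ x ′
  ≤′-swap {x} {y} le with ′-antitone le
  ... | le′ rewrite ′-involutive y = le′

  ′≤-swap : ∀ {x y} → x ′ ≤ y → y ′ ≤ x
  ′≤-swap {x} {y} le with ′-antitone le
  ... | le′ rewrite ′-involutive x = le′

  ′-𝟘 : 𝟘 ′ ≡ 𝟙
  ′-𝟘 = antisym (𝟙-greatest _) (≤′-swap (𝟘-least _))

  ′-𝟙 : 𝟙 ′ ≡ 𝟘
  ′-𝟙 = ′-injective (trans (′-involutive 𝟙) (sym ′-𝟘))

  ⊙-defined⇒′≤ : ∀ {x y w} → x ⊙ y ≡ just w → x ′ ≤ y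
  ⊙-defined⇒′≤ {x} {y} {w} e = proj₁ (⊙-defined x y) (w , e)

  ⊙-decreasing : ∀ {x y w} → x ⊙ y ≡ just w → w ≤ y
  ⊙-decreasing {y = y} e = ⊙-mono (′≤-swap (⊙-defined⇒′≤ e)) (𝟙-greatest _) e (⊙-identityˡ y)

  ⊙-cancel-witness : ∀ {x y} → x ≤ y → ∃ λ w → y ⊙ (x ′) ≡ just w × y ⊙ (w ′) ≡ just x
  ⊙-cancel-witness x≤y = >>=-just (⊙-cancel x≤y)

  ⊙-inverse : ∀ x → x ⊙ (x ′) ≡ just 𝟘
  ⊙-inverse x with ⊙-cancel-witness (𝟘-least x)
  ... | w , x⊙𝟘′≡w , x⊙w′≡𝟘 = subst (λ v → x ⊙ (v ′) ≡ just 𝟘) w≡x x⊙w′≡𝟘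
    where
    w≡x : w ≡ x
    w≡x = just-injective (trans (sym x⊙𝟘′≡w) (trans (cong (x ⊙_) ′-𝟘) (⊙-identityʳ x)))

  ⊙≡𝟘⇒≡′ : ∀ {x y} → x ⊙ y ≡ just 𝟘 → x ≡ y ′
  ⊙≡𝟘⇒≡′ {x} {y} x⊙y≡𝟘 with ⊙-cancel-witness (′≤-swap (⊙-defined⇒′≤ x⊙y≡𝟘))
  ... | w , x⊙y″≡w , x⊙w′≡y′ = just-injective (begin
    just x       ≡⟨ sym (⊙-identityʳ x) ⟩
    x ⊙ 𝟙        ≡⟨ cong (x ⊙_) (sym ′-𝟘) ⟩
    x ⊙ (𝟘 ′)    ≡⟨ cong (λ v → x ⊙ (v ′)) (sym w≡𝟘) ⟩
    x ⊙ (w ′)    ≡⟨ x⊙w′≡y′ ⟩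
    just (y ′)   ∎)
    where
    open ≡-Reasoning
    w≡𝟘 : w ≡ 𝟘
    w≡𝟘 = just-injective (trans (sym x⊙y″≡w) (trans (cong (x ⊙_) (′-involutive y)) x⊙y≡𝟘))

  _+_ : Carrier → Carrier → Maybe Carrier
  _+_ = plusOf 𝐂

  map-′≡just : ∀ {m v} → mapMaybe _′ m ≡ just v → m ≡ just (v ′)
  map-′≡just {just w} refl = cong just (sym (′-involutive w))

  map-′->>= : ∀ (m : Maybe Carrier) (g : Carrier → Maybe Carrier) →
              (mapMaybe _′ m >>= λ a → mapMaybe _′ (g (a ′))) ≡ mapMaybe _′ (m >>= g)
  map-′->>= nothing  g = refl
  map-′->>= (just w) g = cong (λ v → mapMaybe _′ (g v)) (′-involutive w)

  +-comm : ∀ x y → x + y ≡ y + x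
  +-comm x y = cong (mapMaybe _′) (⊙-comm (x ′) (y ′))

  +-assoc : ∀ x y z → assocL _+_ x y z ≡ assocR _+_ x y z
  +-assoc x y z = begin
    assocL _+_ x y z                           ≡⟨ map-′->>= ((x ′) ⊙ (y ′)) (_⊙ (z ′)) ⟩
    mapMaybe _′ (assocL _⊙_ (x ′) (y ′) (z ′)) ≡⟨ cong (mapMaybe _′) (⊙-assoc (x ′) (y ′) (z ′)) ⟩
    mapMaybe _′ (assocR _⊙_ (x ′) (y ′) (z ′)) ≡⟨ map-′->>= ((y ′) ⊙ (z ′)) ((x ′) ⊙_) ⟨
    assocR _+_ x y z                           ∎
    where open ≡-Reasoning

  +-inverse : ∀ x → x + (x ′) ≡ just 𝟙
  +-inverse x = trans (map-just (⊙-inverse (x ′))) (cong just ′-𝟘)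

  +-inverse-unique : ∀ x u → x + u ≡ just 𝟙 → u ≡ x ′
  +-inverse-unique x u x+u≡𝟙 =
    trans (sym (′-involutive u)) (sym (⊙≡𝟘⇒≡′ (trans (map-′≡just x+u≡𝟙) (cong just ′-𝟙))))

  𝟙+-defined⇒≡𝟘 : ∀ x → Defined (𝟙 + x) → x ≡ 𝟘
  𝟙+-defined⇒≡𝟘 x (_ , 𝟙+x≡v) =
    ′-injective (trans (antisym (𝟙-greatest _) 𝟙≤x′) (sym ′-𝟘))
    where
    𝟙≤x′ : 𝟙 ≤ x ′
    𝟙≤x′ = subst (_≤ x ′) (′-involutive 𝟙) (⊙-defined⇒′≤ (map-′≡just 𝟙+x≡v))

  isEffectAlgebra : IsEffectAlgebra _+_ _′ 𝟘 𝟙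
  isEffectAlgebra = record
    { +-comm   = +-comm
    ; +-assoc  = +-assoc
    ; ′-sum    = +-inverse
    ; ′-unique = +-inverse-unique
    ; 𝟙-zero   = 𝟙+-defined⇒≡𝟘
    }

  induced⇒≤ : ∀ {x y} → InducedOrder _+_ x y → x ≤ y
  induced⇒≤ {x} (z , x+z≡y) =
    ′-reflects-≤ (⊙-decreasing (trans (⊙-comm (z ′) (x ′)) (map-′≡just x+z≡y)))

  ≤⇒induced : ∀ {x y} → x ≤ y → InducedOrder _+_ x y
  ≤⇒induced {y = y} x≤y with ⊙-cancel-witness (′-antitone x≤y)
  ... | w , _ , x′⊙w′≡y′ = w , trans (map-just x′⊙w′≡y′) (cong just (′-involutive y))

open StrictUnsharpResiduatedPoset using (_≤_; _′; 𝟘; 𝟙)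

theorem9 : (𝐂 : StrictUnsharpResiduatedPoset) →
    IsEffectAlgebra (plusOf 𝐂) (_′ 𝐂) (𝟘 𝐂) (𝟙 𝐂)
      × (∀ x y → InducedOrder (plusOf 𝐂) x y ⟺ _≤_ 𝐂 x y)
theorem9 𝐂 = isEffectAlgebra , λ x y → induced⇒≤ , ≤⇒induced
  where open Properties 𝐂
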